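{- Let $m\geq 3$ and let $L=\{1^{a_1},2^{a_2},\ldots,m^{a_m}\}$ with nonnegative integers $a_i$ satisfying $a_2\geq a_3\geq\cdots\geq a_m$ and $a_1>a_3$. Then $L$ has a linear realization.
   Context: The notation $\{1^{a_1},\ldots,m^{a_m}\}$ denotes the multiset with $a_i$ copies of $i$. For a list (multiset) $L$ of positive integers with $|L|$ elements, a linear realization of $L$ is an ordering $[x_0,\ldots,x_{|L|}]$ of $\{0,1,\ldots,|L|\}$ such that the multiset $\{|x_i-x_{i+1}|:0\le i\le |L|-1\}$ equals $L$. -}

module Defs where

open import Data.Nat using (ℕ; zero; suc; _+_; _∸_)
open import Data.List using (List; []; _∷_; length; upTo; replicate; concatMap; map)
open import Data.List.Relation.Binary.Permutation.Propositional using (_↭_)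
open import Data.Product using (Σ; _×_)

absDiff : ℕ → ℕ → ℕ
absDiff x y = (x ∸ y) + (y ∸ x)

diffs : List ℕ → List ℕ
diffs [] = []
diffs (x ∷ []) = []
diffs (x ∷ y ∷ xs) = absDiff x y ∷ diffs (y ∷ xs)

-- the multiset {1^{a 1}, 2^{a 2}, ..., m^{a m}} as a list
-- (values a 0 and a i for i > m are ignored)
multList : ℕ → (ℕ → ℕ) → List ℕ
multList m a = concatMap (λ i → replicate (a i) i) (map suc (upTo m))

LinearRealization : List ℕ → Set
LinearRealization L =
  Σ (List ℕ) (λ xs → (xs ↭ upTo (suc (length L))) × (diffs xs ↭ L))

module Submission where

-- The multiset is a stack of layers {1, …, k} on top of a base {1^x, 2^y}
-- with x ≥ 1.  The base is realized explicitly (a block for {1, 2^y} followed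
-- by single steps of 1), and each layer {1, …, n+1} is appended to a
-- realization of L ending at distance y ≤ n below its top |L| by jumping up
-- n+1 and continuing with a graceful path (an ordering of [0..n] with
-- differences 1, …, n) on the next n+1 vertices, started at position n - y.
-- The heart of the file is therefore the fact that every vertex of [0..n]
-- starts a graceful path.  For n = 2r + p (p ≤ 1) and a ≤ r this is shown by
-- strong induction on r, producing a path from a to r + p + a: a zigzag on the
-- outer vertices wraps a smaller path (2a < r), or wraps one around an apex
-- (2a = r), or the case is mirrored onto the first one (2a > r).

open import Defs
open import Data.Nat using (ℕ; zero; suc; _+_; _∸_; _≤_; _<_; z≤n; s≤s; _≤?_; _≤′_; ≤′-refl; ≤′-step)
open import Data.Nat.Properties
open import Data.List using (List; []; _∷_; _++_; length; upTo; map; reverse; [_]; applyUpTo; replicate; concatMap)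
open import Data.List.Properties
  using (++-assoc; unfold-reverse; length-++; length-replicate; ++-identityʳ; map-++; concatMap-++; applyUpTo-∷ʳ)
open import Data.List.Relation.Binary.Permutation.Propositional
  using (_↭_; ↭-refl; ↭-sym; ↭-trans; ↭-reflexive; prep; swap; module PermutationReasoning)
open import Data.List.Relation.Binary.Permutation.Propositional.Properties
  using (map⁺; ++⁺ˡ; ++⁺ʳ; ++⁺; ++-comm; shift; ↭-reverse; All-resp-↭; ↭-length)
open import Data.List.Relation.Unary.All using (All; []; _∷_) renaming (map to All-map)
open import Data.Sum using (inj₁; inj₂)
open import Data.Product using (Σ; _×_; _,_)
open import Data.Nat.Induction using (<-rec)
open import Relation.Binary.Definitions using (tri<; tri≈; tri>)
open import Relation.Nullary using (yes; no)
open import Function using (_∘_; id)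
open import Relation.Binary.PropositionalEquality hiding ([_])
open import Data.Nat.Tactic.RingSolver using (solve-∀)

run : ℕ → ℕ → List ℕ
run s zero = []
run s (suc n) = s ∷ run (suc s) n

run-++ : ∀ s m n → run s (m + n) ≡ run s m ++ run (s + m) n
run-++ s zero n = cong (λ z → run z n) (sym (+-identityʳ s))
run-++ s (suc m) n =
  cong (s ∷_) (trans (run-++ (suc s) m n) (cong (λ z → run (suc s) m ++ run z n) (sym (+-suc s m))))

run-∷ʳ : ∀ s n → run s (suc n) ≡ run s n ++ [ s + n ]
run-∷ʳ s n = trans (cong (run s) (+-comm 1 n)) (run-++ s n 1)

length-run : ∀ s n → length (run s n) ≡ n
length-run s zero = refl
length-run s (suc n) = cong suc (length-run (suc s) n)

upTo≡run : ∀ n → upTo n ≡ run 0 n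
upTo≡run n = applyUpTo≡run n id 0 (λ _ → refl)
  where
  applyUpTo≡run : ∀ n (f : ℕ → ℕ) s → (∀ i → f i ≡ s + i) → applyUpTo f n ≡ run s n
  applyUpTo≡run zero f s eq = refl
  applyUpTo≡run (suc n) f s eq = cong₂ _∷_ (trans (eq 0) (+-identityʳ s))
    (applyUpTo≡run n (f ∘ suc) (suc s) (λ i → trans (eq (suc i)) (+-suc s i)))

map-run : ∀ c s n → map (c +_) (run s n) ≡ run (c + s) n
map-run c s zero = refl
map-run c s (suc n) = cong ((c + s) ∷_) (trans (map-run c (suc s) n) (cong (λ z → run z n) (+-suc c s)))

map-run₀ : ∀ c n → map (c +_) (run 0 n) ≡ run c n
map-run₀ c n = trans (map-run c 0 n) (cong (λ z → run z n) (+-identityʳ c))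

bounded : ∀ {xs} n → xs ↭ run 0 (suc n) → All (_≤ n) xs
bounded n p = All-resp-↭ (↭-sym p) (All-map (λ { (s≤s q) → q }) (below 0 (suc n)))
  where
  below : ∀ s n → All (_< s + n) (run s n)
  below s zero = []
  below s (suc n) = subst (s <_) (sym (+-suc s n)) (s≤s (m≤m+n s n))
    ∷ subst (λ z → All (_< z) (run (suc s) n)) (sym (+-suc s n)) (below (suc s) n)

reflect-run : ∀ n → map (n ∸_) (run 0 (suc n)) ↭ run 0 (suc n)
reflect-run zero = ↭-refl
reflect-run (suc n) = begin
    suc n ∷ map (suc n ∸_) (run 1 (suc n))
  ≡⟨ cong (suc n ∷_) (map-suc n 0 (suc n)) ⟩
    suc n ∷ map (n ∸_) (run 0 (suc n))
  ↭⟨ prep (suc n) (reflect-run n) ⟩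
    suc n ∷ run 0 (suc n)
  ↭⟨ ++-comm [ suc n ] (run 0 (suc n)) ⟩
    run 0 (suc n) ++ [ suc n ]
  ≡⟨ sym (run-∷ʳ 0 (suc n)) ⟩
    run 0 (suc (suc n))
  ∎
  where
  open PermutationReasoning
  map-suc : ∀ c s k → map (suc c ∸_) (run (suc s) k) ≡ map (c ∸_) (run s k)
  map-suc c s zero = refl
  map-suc c s (suc k) = cong ((c ∸ s) ∷_) (map-suc c (suc s) k)

absDiff-comm : ∀ x y → absDiff x y ≡ absDiff y x
absDiff-comm x y = +-comm (x ∸ y) (y ∸ x)

absDiff-+ʳ : ∀ x d → absDiff x (x + d) ≡ d
absDiff-+ʳ x d = cong₂ _+_ (m≤n⇒m∸n≡0 (m≤m+n x d)) (m+n∸m≡n x d)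

absDiff-+ˡ : ∀ x d → absDiff (x + d) x ≡ d
absDiff-+ˡ x d = trans (absDiff-comm (x + d) x) (absDiff-+ʳ x d)

absDiff-translate : ∀ c x y → absDiff (c + x) (c + y) ≡ absDiff x y
absDiff-translate c x y = cong₂ _+_ ([m+n]∸[m+o]≡n∸o c x y) ([m+n]∸[m+o]≡n∸o c y x)

absDiff-reflect-≤ : ∀ c x y → x ≤ y → y ≤ c → absDiff (c ∸ x) (c ∸ y) ≡ absDiff x y
absDiff-reflect-≤ c x y x≤y y≤c with m≤n⇒∃[o]m+o≡n x≤y | m≤n⇒∃[o]m+o≡n y≤c
... | d , refl | e , refl = begin
    absDiff (x + d + e ∸ x) (x + d + e ∸ (x + d))
  ≡⟨ cong₂ absDiff (trans (cong (_∸ x) (+-assoc x d e)) (m+n∸m≡n x (d + e))) (m+n∸m≡n (x + d) e) ⟩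
    absDiff (d + e) e
  ≡⟨ cong (λ z → absDiff z e) (+-comm d e) ⟩
    absDiff (e + d) e
  ≡⟨ absDiff-+ˡ e d ⟩
    d
  ≡⟨ sym (absDiff-+ʳ x d) ⟩
    absDiff x (x + d)
  ∎
  where open ≡-Reasoning

absDiff-reflect : ∀ c x y → x ≤ c → y ≤ c → absDiff (c ∸ x) (c ∸ y) ≡ absDiff x y
absDiff-reflect c x y x≤c y≤c with ≤-total x y
... | inj₁ x≤y = absDiff-reflect-≤ c x y x≤y y≤c
... | inj₂ y≤x = begin
    absDiff (c ∸ x) (c ∸ y)  ≡⟨ absDiff-comm (c ∸ x) (c ∸ y) ⟩
    absDiff (c ∸ y) (c ∸ x)  ≡⟨ absDiff-reflect-≤ c y x y≤x x≤c ⟩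
    absDiff y x              ≡⟨ absDiff-comm y x ⟩
    absDiff x y              ∎
  where open ≡-Reasoning

data Ends : List ℕ → ℕ → ℕ → Set where
  one  : ∀ x → Ends (x ∷ []) x x
  cons : ∀ x {y e ys} → Ends (y ∷ ys) y e → Ends (x ∷ y ∷ ys) x e

Ends-∷ : ∀ x {xs a e} → Ends xs a e → Ends (x ∷ xs) x e
Ends-∷ x p@(one _) = cons x p
Ends-∷ x p@(cons _ _) = cons x p

Ends-++ : ∀ {xs ys a e b f} → Ends xs a e → Ends ys b f → Ends (xs ++ ys) a f
Ends-++ (one x) q = Ends-∷ x q
Ends-++ (cons x p) q = cons x (Ends-++ p q)

Ends-map : ∀ (g : ℕ → ℕ) {xs a e} → Ends xs a e → Ends (map g xs) (g a) (g e)
Ends-map g (one x) = one (g x)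
Ends-map g (cons x p) = cons (g x) (Ends-map g p)

Ends-reverse : ∀ {xs a e} → Ends xs a e → Ends (reverse xs) e a
Ends-reverse (one x) = one x
Ends-reverse (cons x {y} {e} {ys} p) =
  subst (λ z → Ends z e x) (sym (unfold-reverse x (y ∷ ys))) (Ends-++ (Ends-reverse p) (one x))

Ends-last : ∀ {P : ℕ → Set} {xs a e} → Ends xs a e → All P xs → P e
Ends-last (one x) (px ∷ _) = px
Ends-last (cons x p) (_ ∷ ps) = Ends-last p ps

diffs-∷ : ∀ x {xs a e} → Ends xs a e → diffs (x ∷ xs) ≡ absDiff x a ∷ diffs xs
diffs-∷ x (one _) = refl
diffs-∷ x (cons _ _) = refl

diffs-++ : ∀ {xs ys a e b f} → Ends xs a e → Ends ys b f →
           diffs (xs ++ ys) ≡ diffs xs ++ absDiff e b ∷ diffs ys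
diffs-++ (one x) q = diffs-∷ x q
diffs-++ (cons x {y} p) q = cong (absDiff x y ∷_) (diffs-++ p q)

diffs-translate : ∀ c xs → diffs (map (c +_) xs) ≡ diffs xs
diffs-translate c [] = refl
diffs-translate c (x ∷ []) = refl
diffs-translate c (x ∷ y ∷ xs) = cong₂ _∷_ (absDiff-translate c x y) (diffs-translate c (y ∷ xs))

diffs-reflect : ∀ c xs → All (_≤ c) xs → diffs (map (c ∸_) xs) ≡ diffs xs
diffs-reflect c [] _ = refl
diffs-reflect c (x ∷ []) _ = refl
diffs-reflect c (x ∷ y ∷ xs) (px ∷ py ∷ ps) =
  cong₂ _∷_ (absDiff-reflect c x y px py) (diffs-reflect c (y ∷ xs) (py ∷ ps))

diffs-reverse : ∀ {xs a e} → Ends xs a e → diffs (reverse xs) ↭ diffs xs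
diffs-reverse (one x) = ↭-refl
diffs-reverse (cons x {y} {e} {ys} p) = begin
    diffs (reverse (x ∷ y ∷ ys))
  ≡⟨ cong diffs (unfold-reverse x (y ∷ ys)) ⟩
    diffs (reverse (y ∷ ys) ++ [ x ])
  ≡⟨ diffs-++ (Ends-reverse p) (one x) ⟩
    diffs (reverse (y ∷ ys)) ++ [ absDiff y x ]
  ↭⟨ ++⁺ʳ _ (diffs-reverse p) ⟩
    diffs (y ∷ ys) ++ [ absDiff y x ]
  ↭⟨ ++-comm (diffs (y ∷ ys)) [ absDiff y x ] ⟩
    absDiff y x ∷ diffs (y ∷ ys)
  ≡⟨ cong (_∷ diffs (y ∷ ys)) (absDiff-comm y x) ⟩
    absDiff x y ∷ diffs (y ∷ ys)
  ∎
  where open PermutationReasoning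

record Graceful (n a e : ℕ) : Set where
  constructor graceful
  field
    path : List ℕ
    ends : Ends path a e
    vertices : path ↭ run 0 (suc n)
    differences : diffs path ↭ run 1 n

Graceful-cast : ∀ {n a e n′ a′ e′} → n ≡ n′ → a ≡ a′ → e ≡ e′ → Graceful n a e → Graceful n′ a′ e′
Graceful-cast refl refl refl g = g

Graceful-reverse : ∀ {n a e} → Graceful n a e → Graceful n e a
Graceful-reverse (graceful p en v d) =
  graceful (reverse p) (Ends-reverse en) (↭-trans (↭-reverse p) v) (↭-trans (diffs-reverse en) d)

Graceful-reflect : ∀ {n a e} → Graceful n a e → Graceful n (n ∸ a) (n ∸ e)
Graceful-reflect {n} (graceful p en v d) =
  graceful (map (n ∸_) p) (Ends-map (n ∸_) en) (↭-trans (map⁺ (n ∸_) v) (reflect-run n))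
    (↭-trans (↭-reflexive (diffs-reflect n p (bounded n v))) d)

-- The zigzag i d = [i, i+d, i-1, i+d+1, …, 0, 2i+d] visits [0..i] and
-- [i+d..2i+d] using the 2i+1 consecutive differences d, d+1, …, d+2i.
-- (Defined mutually with its tail so that the first two entries are visible
-- for every i.)
mutual
  zigzag : ℕ → ℕ → List ℕ
  zigzag i d = i ∷ i + d ∷ zigzag-tail i d

  zigzag-tail : ℕ → ℕ → List ℕ
  zigzag-tail zero d = []
  zigzag-tail (suc i) d = zigzag i (suc (suc d))

Ends-zigzag : ∀ i d → Ends (zigzag i d) i (i + i + d)
Ends-zigzag zero d = cons 0 (one d)
Ends-zigzag (suc i) d = subst (Ends (zigzag (suc i) d) (suc i)) (lastEq i d)
  (cons (suc i) (cons (suc i + d) (Ends-zigzag i (suc (suc d)))))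
  where
  lastEq : ∀ i d → i + i + suc (suc d) ≡ suc i + suc i + d
  lastEq = solve-∀

diffs-zigzag : ∀ i d → diffs (zigzag i d) ≡ run d (suc (i + i))
diffs-zigzag zero d = cong (_∷ []) (absDiff-+ʳ 0 d)
diffs-zigzag (suc i) d = begin
    absDiff (suc i) (suc i + d) ∷ absDiff (suc i + d) i ∷ diffs (zigzag i (suc (suc d)))
  ≡⟨ cong₂ (λ u w → u ∷ w ∷ diffs (zigzag i (suc (suc d)))) (absDiff-+ʳ (suc i) d)
       (trans (cong (λ z → absDiff z i) (sym (+-suc i d))) (absDiff-+ˡ i (suc d))) ⟩
    d ∷ suc d ∷ diffs (zigzag i (suc (suc d)))
  ≡⟨ cong (λ z → d ∷ suc d ∷ z) (diffs-zigzag i (suc (suc d))) ⟩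
    d ∷ suc d ∷ run (suc (suc d)) (suc (i + i))
  ≡⟨ cong (λ z → run d (suc (suc z))) (sym (+-suc i i)) ⟩
    run d (suc (suc i + suc i))
  ∎
  where open ≡-Reasoning

vertices-zigzag : ∀ i d → zigzag i d ↭ run 0 (suc i) ++ run (i + d) (suc i)
vertices-zigzag zero d = ↭-refl
vertices-zigzag (suc i) d = begin
    suc i ∷ (suc i + d) ∷ zigzag i (suc (suc d))
  ↭⟨ prep (suc i) (prep (suc i + d) (vertices-zigzag i (suc (suc d)))) ⟩
    suc i ∷ (suc i + d) ∷ (A ++ B)
  ↭⟨ prep (suc i) (↭-sym (shift (suc i + d) A B)) ⟩
    suc i ∷ (A ++ (suc i + d) ∷ B)
  ↭⟨ ↭-sym (shift (suc i) A ((suc i + d) ∷ B)) ⟩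
    A ++ suc i ∷ (suc i + d) ∷ B
  ≡⟨ sym (++-assoc A [ suc i ] ((suc i + d) ∷ B)) ⟩
    (A ++ [ suc i ]) ++ (suc i + d) ∷ B
  ≡⟨ cong₂ _++_ (sym (run-∷ʳ 0 (suc i))) (cong (λ z → (suc i + d) ∷ run z (suc i)) (startEq i d)) ⟩
    run 0 (suc (suc i)) ++ run (suc i + d) (suc (suc i))
  ∎
  where
  open PermutationReasoning
  A = run 0 (suc i)
  B = run (i + suc (suc d)) (suc i)
  startEq : ∀ i d → i + suc (suc d) ≡ suc (suc i + d)
  startEq = solve-∀

-- If [0..l] has a graceful path p starting at a, then so does
-- [0..2a+l+2]: run the zigzag a (l+2) on the outer parts [0..a] and
-- [a+l+2..2a+l+2], then jump (difference l+1) into p translated to [a+1..a+l+1].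
wrapPath : ℕ → ℕ → List ℕ → List ℕ
wrapPath a l p = zigzag a (suc (suc l)) ++ map (suc a +_) p

Ends-wrapPath : ∀ {a l p e} → Ends p a e → Ends (wrapPath a l p) a (suc a + e)
Ends-wrapPath {a} {l} en = Ends-++ (Ends-zigzag a (suc (suc l))) (Ends-map (suc a +_) en)

diffs-wrapPath : ∀ {a l p e} → Ends p a e → diffs p ↭ run 1 l →
                 diffs (wrapPath a l p) ↭ run 1 (a + a + suc (suc l))
diffs-wrapPath {a} {l} {p} en d = begin
    diffs (wrapPath a l p)
  ≡⟨ diffs-++ (Ends-zigzag a (suc (suc l))) (Ends-map (suc a +_) en) ⟩
    diffs (zigzag a (suc (suc l))) ++ absDiff (a + a + suc (suc l)) (suc a + a) ∷ diffs (map (suc a +_) p)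
  ≡⟨ cong₂ _++_ (diffs-zigzag a (suc (suc l)))
       (cong₂ _∷_ (trans (cong (λ z → absDiff z (suc a + a)) (jumpEq a l)) (absDiff-+ˡ (suc a + a) (suc l)))
                  (diffs-translate (suc a) p)) ⟩
    G ++ suc l ∷ diffs p
  ↭⟨ ++⁺ˡ G (prep (suc l) d) ⟩
    G ++ suc l ∷ run 1 l
  ↭⟨ ++-comm G (suc l ∷ run 1 l) ⟩
    suc l ∷ run 1 l ++ G
  ↭⟨ ↭-sym (shift (suc l) (run 1 l) G) ⟩
    run 1 l ++ run (suc l) (suc (suc (a + a)))
  ≡⟨ sym (run-++ 1 l (suc (suc (a + a)))) ⟩
    run 1 (l + suc (suc (a + a)))
  ≡⟨ cong (run 1) (sizeEq a l) ⟩
    run 1 (a + a + suc (suc l))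
  ∎
  where
  open PermutationReasoning
  G = run (suc (suc l)) (suc (a + a))
  jumpEq : ∀ a l → a + a + suc (suc l) ≡ suc a + a + suc l
  jumpEq = solve-∀
  sizeEq : ∀ a l → l + suc (suc (a + a)) ≡ a + a + suc (suc l)
  sizeEq = solve-∀

vertices-wrapPath : ∀ a l {p} → p ↭ run 0 (suc l) → wrapPath a l p ↭ run 0 (suc (a + a + suc (suc l)))
vertices-wrapPath a l {p} v = begin
    wrapPath a l p
  ↭⟨ ++⁺ (vertices-zigzag a (suc (suc l))) (↭-trans (map⁺ (suc a +_) v) (↭-reflexive (map-run₀ (suc a) (suc l)))) ⟩
    (A ++ B) ++ C
  ≡⟨ ++-assoc A B C ⟩
    A ++ (B ++ C)
  ↭⟨ ++⁺ˡ A (++-comm B C) ⟩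
    A ++ (C ++ B)
  ≡⟨ sym (++-assoc A C B) ⟩
    (A ++ C) ++ B
  ≡⟨ cong₂ _++_ (sym (run-++ 0 (suc a) (suc l))) (cong (λ z → run z (suc a)) (outerEq a l)) ⟩
    run 0 (suc a + suc l) ++ run (suc a + suc l) (suc a)
  ≡⟨ sym (run-++ 0 (suc a + suc l) (suc a)) ⟩
    run 0 (suc a + suc l + suc a)
  ≡⟨ cong (run 0) (totalEq a l) ⟩
    run 0 (suc (a + a + suc (suc l)))
  ∎
  where
  open PermutationReasoning
  A = run 0 (suc a)
  B = run (a + suc (suc l)) (suc a)
  C = run (suc a) (suc l)
  outerEq : ∀ a l → a + suc (suc l) ≡ suc a + suc l
  outerEq = solve-∀
  totalEq : ∀ a l → suc a + suc l + suc a ≡ suc (a + a + suc (suc l))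
  totalEq = solve-∀

wrap : ∀ {a l e} → Graceful l a e → Graceful (a + a + suc (suc l)) a (suc a + e)
wrap {a} {l} (graceful p en v d) =
  graceful (wrapPath a l p) (Ends-wrapPath en) (vertices-wrapPath a l v) (diffs-wrapPath en d)

-- If [0..m] has a graceful path p starting at i+1,
-- then [0..2i+m+3] has one from the apex i+m+2: step down to i (difference
-- m+2), run the zigzag i (m+3), then jump (difference m+1) into p translated
-- to [i+1..i+m+1].
apexPath : ℕ → ℕ → List ℕ → List ℕ
apexPath i m p = i + suc (suc m) ∷ (zigzag i (suc (suc (suc m))) ++ map (suc i +_) p)

Ends-apexPath : ∀ {i m p s} → Ends p (suc i) s → Ends (apexPath i m p) (i + suc (suc m)) (suc i + s)
Ends-apexPath {i} {m} en = cons (i + suc (suc m)) (Ends-++ (Ends-zigzag i (suc (suc (suc m)))) (Ends-map (suc i +_) en))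

diffs-apexPath : ∀ {i m p s} → Ends p (suc i) s → diffs p ↭ run 1 m →
                 diffs (apexPath i m p) ↭ run 1 (i + i + suc (suc (suc m)))
diffs-apexPath {i} {m} {p} en d = begin
    absDiff (i + suc (suc m)) i ∷ diffs (zigzag i z ++ map (suc i +_) p)
  ≡⟨ cong₂ _∷_ (absDiff-+ˡ i (suc (suc m))) (diffs-++ (Ends-zigzag i z) (Ends-map (suc i +_) en)) ⟩
    suc (suc m) ∷ (diffs (zigzag i z) ++ absDiff (i + i + z) (suc i + suc i) ∷ diffs (map (suc i +_) p))
  ≡⟨ cong (suc (suc m) ∷_) (cong₂ _++_ (diffs-zigzag i z)
       (cong₂ _∷_ (trans (cong (λ w → absDiff w (suc i + suc i)) (jumpEq i m)) (absDiff-+ˡ (suc i + suc i) (suc m)))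
                  (diffs-translate (suc i) p))) ⟩
    suc (suc m) ∷ (G ++ suc m ∷ diffs p)
  ↭⟨ prep (suc (suc m)) (++⁺ˡ G (prep (suc m) d)) ⟩
    suc (suc m) ∷ (G ++ suc m ∷ run 1 m)
  ↭⟨ prep (suc (suc m)) (shift (suc m) G (run 1 m)) ⟩
    suc (suc m) ∷ suc m ∷ (G ++ run 1 m)
  ↭⟨ swap (suc (suc m)) (suc m) (++-comm G (run 1 m)) ⟩
    suc m ∷ suc (suc m) ∷ (run 1 m ++ G)
  ↭⟨ prep (suc m) (↭-sym (shift (suc (suc m)) (run 1 m) G)) ⟩
    suc m ∷ (run 1 m ++ suc (suc m) ∷ G)
  ↭⟨ ↭-sym (shift (suc m) (run 1 m) (suc (suc m) ∷ G)) ⟩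
    run 1 m ++ run (suc m) (suc (suc (suc (i + i))))
  ≡⟨ sym (run-++ 1 m (suc (suc (suc (i + i))))) ⟩
    run 1 (m + suc (suc (suc (i + i))))
  ≡⟨ cong (run 1) (sizeEq i m) ⟩
    run 1 (i + i + z)
  ∎
  where
  open PermutationReasoning
  z = suc (suc (suc m))
  G = run z (suc (i + i))
  jumpEq : ∀ i m → i + i + suc (suc (suc m)) ≡ suc i + suc i + suc m
  jumpEq = solve-∀
  sizeEq : ∀ i m → m + suc (suc (suc (i + i))) ≡ i + i + suc (suc (suc m))
  sizeEq = solve-∀

vertices-apexPath : ∀ i m {p} → p ↭ run 0 (suc m) → apexPath i m p ↭ run 0 (suc (i + i + suc (suc (suc m))))
vertices-apexPath i m {p} v = begin
    apex ∷ (zigzag i z ++ map (suc i +_) p)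
  ↭⟨ prep apex (++⁺ (vertices-zigzag i z) (↭-trans (map⁺ (suc i +_) v) (↭-reflexive (map-run₀ (suc i) (suc m))))) ⟩
    apex ∷ ((A ++ B) ++ C)
  ≡⟨ cong (apex ∷_) (++-assoc A B C) ⟩
    apex ∷ (A ++ (B ++ C))
  ↭⟨ prep apex (++⁺ˡ A (++-comm B C)) ⟩
    apex ∷ (A ++ (C ++ B))
  ≡⟨ cong (apex ∷_) (sym (++-assoc A C B)) ⟩
    apex ∷ ((A ++ C) ++ B)
  ↭⟨ ↭-sym (shift apex (A ++ C) B) ⟩
    (A ++ C) ++ apex ∷ B
  ≡⟨ cong₂ _++_ (sym (run-++ 0 (suc i) (suc m))) (cong₂ (λ u w → u ∷ run w (suc i)) (apexEq i m) (upperEq i m)) ⟩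
    run 0 (suc i + suc m) ++ run (suc i + suc m) (suc (suc i))
  ≡⟨ sym (run-++ 0 (suc i + suc m) (suc (suc i))) ⟩
    run 0 (suc i + suc m + suc (suc i))
  ≡⟨ cong (run 0) (totalEq i m) ⟩
    run 0 (suc (i + i + z))
  ∎
  where
  open PermutationReasoning
  z = suc (suc (suc m))
  apex = i + suc (suc m)
  A = run 0 (suc i)
  B = run (i + z) (suc i)
  C = run (suc i) (suc m)
  apexEq : ∀ i m → i + suc (suc m) ≡ suc i + suc m
  apexEq = solve-∀
  upperEq : ∀ i m → i + suc (suc (suc m)) ≡ suc (suc i + suc m)
  upperEq = solve-∀
  totalEq : ∀ i m → suc i + suc m + suc (suc i) ≡ suc (i + i + suc (suc (suc m)))
  totalEq = solve-∀

apexWrap : ∀ {i m s} → Graceful m (suc i) s →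
           Graceful (i + i + suc (suc (suc m))) (i + suc (suc m)) (suc i + s)
apexWrap {i} {m} (graceful p en v d) =
  graceful (apexPath i m p) (Ends-apexPath en) (vertices-apexPath i m v) (diffs-apexPath en d)

Graceful-mirror : ∀ {n a e} → Graceful n a e → Graceful n (n ∸ e) (n ∸ a)
Graceful-mirror = Graceful-reverse ∘ Graceful-reflect

∸-by : ∀ {n x y} → n ≡ x + y → n ∸ y ≡ x
∸-by {x = x} {y} refl = m+n∸n≡m x y

HalfFamily : ℕ → Set
HalfFamily r = ∀ p a → p ≤ 1 → a ≤ r → Graceful (r + r + p) a (r + p + a)

Below : ℕ → Set
Below r = ∀ {r′} → r′ < r → HalfFamily r′

-- Case 2a < r: wrap the path of the family for r - a - 1 starting at a.
outerCase : ∀ {r} → Below r → ∀ p a → p ≤ 1 → a + a < r → Graceful (r + r + p) a (r + p + a)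
outerCase IH p a p≤1 2a<r with m≤n⇒∃[o]m+o≡n 2a<r
... | k , refl = Graceful-cast (sizeEq a k p) refl (endEq a k p)
                   (wrap (IH {a + k} (s≤s (+-monoˡ-≤ k (m≤m+n a a))) p a p≤1 (m≤m+n a k)))
  where
  sizeEq : ∀ a k p → a + a + suc (suc ((a + k) + (a + k) + p)) ≡ suc (a + a) + k + (suc (a + a) + k) + p
  sizeEq = solve-∀
  endEq : ∀ a k p → suc a + ((a + k) + p + a) ≡ suc (a + a) + k + p + a
  endEq = solve-∀

apexCase : ∀ i p m → m ≡ i + i + suc p → Graceful m 0 (suc i) →
           Graceful (suc i + suc i + (suc i + suc i) + p) (suc i) (suc i + suc i + p + suc i)
apexCase i p m refl Z =
  Graceful-cast (sizeEq i p) (+-identityʳ (suc i)) (endEq i p) (Graceful-reverse (apexWrap (Graceful-reverse Z)))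
  where
  sizeEq : ∀ i p → i + i + suc (suc (suc (i + i + suc p))) ≡ suc i + suc i + (suc i + suc i) + p
  sizeEq = solve-∀
  endEq : ∀ i p → i + suc (suc (i + i + suc p)) ≡ suc i + suc i + p + suc i
  endEq = solve-∀

-- Case 2a = r: for a = 0 the paths [0] and [0,1]; for a = i+1 an apex wrap
-- of the family member from 0 to i+1 on [0..2i+p+1] (r′ = i or i+1 < r).
balancedCase : ∀ {r} → Below r → ∀ p a → p ≤ 1 → a + a ≡ r → Graceful (r + r + p) a (r + p + a)
balancedCase IH zero zero _ refl = graceful (0 ∷ []) (one 0) ↭-refl ↭-refl
balancedCase IH (suc zero) zero _ refl = graceful (0 ∷ 1 ∷ []) (cons 0 (one 1)) ↭-refl ↭-refl
balancedCase IH (suc (suc p)) a (s≤s ()) _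
balancedCase IH zero (suc i) _ refl =
  apexCase i 0 (i + i + 1) refl
    (Graceful-cast refl refl (trans (+-identityʳ (i + 1)) (+-comm i 1)) (IH {i} (s≤s (m≤m+n i (suc i))) 1 0 (s≤s z≤n) z≤n))
balancedCase IH (suc zero) (suc i) _ refl =
  apexCase i 1 (suc i + suc i + 0) (sizeEq i)
    (Graceful-cast refl refl (trans (+-identityʳ (suc i + 0)) (+-identityʳ (suc i)))
      (IH {suc i} (s≤s (m≤n+m (suc i) i)) 0 0 z≤n z≤n))
  where
  sizeEq : ∀ i → suc i + suc i + 0 ≡ i + i + 2
  sizeEq = solve-∀

-- Case r < 2a: mirror the path of the outer case for a′ = r - a, which starts
-- at a′ and ends at r + p + a′.
innerCase : ∀ {r} → Below r → ∀ p a → p ≤ 1 → a ≤ r → r < a + a → Graceful (r + r + p) a (r + p + a)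
innerCase IH p a p≤1 a≤r r<2a with m≤n⇒∃[o]m+o≡n a≤r
... | b , refl = Graceful-cast refl (∸-by (startEq a b p)) (∸-by (endEq a b p))
                   (Graceful-mirror (outerCase IH p b p≤1 (+-monoˡ-< b (+-cancelˡ-< a b a r<2a))))
  where
  startEq : ∀ a b p → (a + b) + (a + b) + p ≡ a + ((a + b) + p + b)
  startEq = solve-∀
  endEq : ∀ a b p → (a + b) + (a + b) + p ≡ ((a + b) + p + a) + b
  endEq = solve-∀

halfFamily : ∀ r → HalfFamily r
halfFamily = <-rec HalfFamily step
  where
  step : ∀ r → Below r → HalfFamily r
  step r IH p a p≤1 a≤r with <-cmp (a + a) r
  ... | tri< 2a<r _ _ = outerCase IH p a p≤1 2a<r
  ... | tri≈ _ 2a≡r _ = balancedCase IH p a p≤1 2a≡r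
  ... | tri> _ _ r<2a = innerCase IH p a p≤1 a≤r r<2a

halve : ∀ n → Σ ℕ λ r → Σ ℕ λ p → p ≤ 1 × r + r + p ≡ n
halve zero = 0 , 0 , z≤n , refl
halve (suc n) with halve n
... | r , zero , _ , refl = r , 1 , s≤s z≤n , evenEq r
  where
  evenEq : ∀ r → r + r + 1 ≡ suc (r + r + 0)
  evenEq = solve-∀
... | r , suc zero , _ , refl = suc r , 0 , z≤n , oddEq r
  where
  oddEq : ∀ r → suc r + suc r + 0 ≡ suc (r + r + 1)
  oddEq = solve-∀
... | r , suc (suc p) , s≤s () , _

-- Every vertex s of [0..n] starts a graceful path: for s ≤ ⌊n/2⌋ take the
-- family above, otherwise reflect the path that starts at n - s.
gracefulFrom : ∀ n s → s ≤ n → Σ ℕ (Graceful n s)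
gracefulFrom n s s≤n with halve n
... | r , p , p≤1 , refl with s ≤? r
...   | yes s≤r = r + p + s , halfFamily r p s p≤1 s≤r
...   | no s≰r = _ , Graceful-cast refl (m∸[m∸n]≡n s≤n) refl
                      (Graceful-reflect (halfFamily r p (r + r + p ∸ s) p≤1 reflected≤r))
  where
  reflected≤r : r + r + p ∸ s ≤ r
  reflected≤r = m≤n+o⇒m∸n≤o (r + r + p) s (begin
      r + r + p    ≤⟨ +-monoʳ-≤ (r + r) p≤1 ⟩
      r + r + 1    ≡⟨ trans (+-assoc r r 1) (+-comm r (r + 1)) ⟩
      r + 1 + r    ≤⟨ +-monoˡ-≤ r (subst (_≤ s) (+-comm 1 r) (≰⇒> s≰r)) ⟩
      s + r        ∎)
    where open ≤-Reasoning

stack : ∀ {xs ys} k k′ → xs ↭ run 0 k → ys ↭ run 0 k′ → xs ++ map (k +_) ys ↭ run 0 (k + k′)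
stack k k′ vx vy =
  ↭-trans (++⁺ vx (↭-trans (map⁺ (k +_) vy) (↭-reflexive (map-run₀ k k′)))) (↭-reflexive (sym (run-++ 0 k k′)))

record Realization (L : List ℕ) (y : ℕ) : Set where
  constructor realization
  field
    path : List ℕ
    first last : ℕ
    ends : Ends path first last
    gap : last + y ≡ length L
    vertices : path ↭ run 0 (suc (length L))
    differences : diffs path ↭ L

Realization-resp : ∀ {L L′ y} → L ↭ L′ → Realization L y → Realization L′ y
Realization-resp {L} {L′} L↭L′ (realization xs s t en gap vx dx) =
  realization xs s t en (trans gap (↭-length L↭L′))
    (subst (λ z → xs ↭ run 0 (suc z)) (↭-length L↭L′) vx) (↭-trans dx L↭L′)

-- A realization of L open y ≤ n below the top
-- extends to one of L ∪ {1, …, n+1}: jump up by n+1 to vertex |L|+1+(n-y) and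
-- append the graceful path on [|L|+1..|L|+n+1] starting there.
extend : ∀ {L y} n → y ≤ n → Realization L y →
         Σ ℕ λ y′ → y′ ≤ n × Realization (L ++ run 1 (suc n)) y′
extend {L} {y} n y≤n (realization xs s t en gap vx dx) with gracefulFrom n (n ∸ y) (m∸n≤m n y)
... | e , graceful p enp vp dp = n ∸ e , m∸n≤m n e , realization (xs ++ X) s (suc N + e) E gap′ V D
  where
  N = length L
  X = map (suc N +_) p
  EX : Ends X (suc N + (n ∸ y)) (suc N + e)
  EX = Ends-map (suc N +_) enp
  E = Ends-++ en EX
  e≤n : e ≤ n
  e≤n = Ends-last enp (bounded n vp)
  size : length (L ++ run 1 (suc n)) ≡ N + suc n
  size = trans (length-++ L) (cong (N +_) (length-run 1 (suc n)))
  gap′ : suc N + e + (n ∸ e) ≡ length (L ++ run 1 (suc n))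
  gap′ = begin
      suc N + e + (n ∸ e)   ≡⟨ +-assoc (suc N) e (n ∸ e) ⟩
      suc N + (e + (n ∸ e)) ≡⟨ cong (suc N +_) (m+[n∸m]≡n e≤n) ⟩
      suc N + n             ≡⟨ sym (+-suc N n) ⟩
      N + suc n             ≡⟨ sym size ⟩
      length (L ++ run 1 (suc n)) ∎
    where open ≡-Reasoning
  entry : suc N + (n ∸ y) ≡ t + suc n
  entry = begin
      suc N + (n ∸ y)        ≡⟨ cong (λ z → suc z + (n ∸ y)) (sym gap) ⟩
      suc (t + y) + (n ∸ y)  ≡⟨ cong suc (+-assoc t y (n ∸ y)) ⟩
      suc (t + (y + (n ∸ y))) ≡⟨ cong (λ z → suc (t + z)) (m+[n∸m]≡n y≤n) ⟩
      suc (t + n)            ≡⟨ sym (+-suc t n) ⟩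
      t + suc n              ∎
    where open ≡-Reasoning
  V : xs ++ X ↭ run 0 (suc (length (L ++ run 1 (suc n))))
  V = ↭-trans (stack (suc N) (suc n) vx vp) (↭-reflexive (cong (λ z → run 0 (suc z)) (sym size)))
  D : diffs (xs ++ X) ↭ L ++ run 1 (suc n)
  D = begin
      diffs (xs ++ X)
    ≡⟨ diffs-++ en EX ⟩
      diffs xs ++ absDiff t (suc N + (n ∸ y)) ∷ diffs X
    ≡⟨ cong (λ z → diffs xs ++ z ∷ diffs X) (trans (cong (absDiff t) entry) (absDiff-+ʳ t (suc n))) ⟩
      diffs xs ++ suc n ∷ diffs X
    ↭⟨ ++⁺ dx (prep (suc n) (↭-trans (↭-reflexive (diffs-translate (suc N) p)) dp)) ⟩
      L ++ suc n ∷ run 1 n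
    ↭⟨ ++⁺ˡ L (++-comm [ suc n ] (run 1 n)) ⟩
      L ++ (run 1 n ++ [ suc n ])
    ≡⟨ cong (L ++_) (sym (run-∷ʳ 1 n)) ⟩
      L ++ run 1 (suc n)
    ∎
    where open PermutationReasoning

twos : ℕ → List ℕ
twos zero = 0 ∷ 1 ∷ []
twos (suc zero) = 1 ∷ 0 ∷ 2 ∷ []
twos (suc (suc b)) = suc (suc b) ∷ (twos b ++ [ suc (suc (suc b)) ])

Ends-twos : ∀ b → Ends (twos b) b (suc b)
Ends-twos zero = cons 0 (one 1)
Ends-twos (suc zero) = cons 1 (cons 0 (one 2))
Ends-twos (suc (suc b)) = Ends-∷ (suc (suc b)) (Ends-++ (Ends-twos b) (one (suc (suc (suc b)))))

diffs-twos : ∀ b → diffs (twos b) ↭ 1 ∷ replicate b 2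
diffs-twos zero = ↭-refl
diffs-twos (suc zero) = ↭-refl
diffs-twos (suc (suc b)) = begin
    diffs (suc (suc b) ∷ (twos b ++ [ suc (suc (suc b)) ]))
  ≡⟨ diffs-∷ (suc (suc b)) (Ends-++ (Ends-twos b) (one (suc (suc (suc b))))) ⟩
    absDiff (suc (suc b)) b ∷ diffs (twos b ++ [ suc (suc (suc b)) ])
  ≡⟨ cong₂ _∷_ (trans (cong (λ z → absDiff z b) (+-comm 2 b)) (absDiff-+ˡ b 2))
               (diffs-++ (Ends-twos b) (one (suc (suc (suc b))))) ⟩
    2 ∷ (diffs (twos b) ++ [ absDiff (suc b) (suc (suc (suc b))) ])
  ≡⟨ cong (λ z → 2 ∷ (diffs (twos b) ++ [ z ])) (trans (cong (absDiff (suc b)) (+-comm 2 (suc b))) (absDiff-+ʳ (suc b) 2)) ⟩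
    2 ∷ (diffs (twos b) ++ [ 2 ])
  ↭⟨ prep 2 (++⁺ʳ [ 2 ] (diffs-twos b)) ⟩
    2 ∷ ((1 ∷ replicate b 2) ++ [ 2 ])
  ↭⟨ prep 2 (++-comm (1 ∷ replicate b 2) [ 2 ]) ⟩
    2 ∷ 2 ∷ 1 ∷ replicate b 2
  ↭⟨ prep 2 (swap 2 1 ↭-refl) ⟩
    2 ∷ 1 ∷ 2 ∷ replicate b 2
  ↭⟨ swap 2 1 ↭-refl ⟩
    1 ∷ 2 ∷ 2 ∷ replicate b 2
  ∎
  where open PermutationReasoning

vertices-twos : ∀ b → twos b ↭ run 0 (suc (suc b))
vertices-twos zero = ↭-refl
vertices-twos (suc zero) = swap 1 0 ↭-refl
vertices-twos (suc (suc b)) = begin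
    suc (suc b) ∷ (twos b ++ [ suc (suc (suc b)) ])
  ↭⟨ prep (suc (suc b)) (++⁺ʳ _ (vertices-twos b)) ⟩
    suc (suc b) ∷ (run 0 (suc (suc b)) ++ [ suc (suc (suc b)) ])
  ↭⟨ ↭-sym (shift (suc (suc b)) (run 0 (suc (suc b))) [ suc (suc (suc b)) ]) ⟩
    run 0 (suc (suc b)) ++ run (suc (suc b)) 2
  ≡⟨ sym (run-++ 0 (suc (suc b)) 2) ⟩
    run 0 (suc (suc b) + 2)
  ≡⟨ cong (run 0) (+-comm (suc (suc b)) 2) ⟩
    run 0 (suc (suc (suc (suc b))))
  ∎
  where open PermutationReasoning

twosRealization : ∀ b → Realization (1 ∷ replicate b 2) 0
twosRealization b = realization (twos b) b (suc b) (Ends-twos b)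
  (trans (+-identityʳ (suc b)) (cong suc (sym (length-replicate b))))
  (subst (λ z → twos b ↭ run 0 (suc (suc z))) (sym (length-replicate b)) (vertices-twos b))
  (diffs-twos b)

appendOnes : ∀ k {L} → Realization L 0 → Realization (L ++ replicate k 1) 0
appendOnes zero {L} R = subst (λ z → Realization z 0) (sym (++-identityʳ L)) R
appendOnes (suc k) {L} R with extend 0 z≤n R
... | zero , _ , R′ = subst (λ z → Realization z 0) (++-assoc L [ 1 ] (replicate k 1)) (appendOnes k R′)

multList-suc : ∀ m a → multList (suc m) a ≡ multList m a ++ replicate (a (suc m)) (suc m)
multList-suc m a = begin
    concatMap copies (map suc (upTo (suc m)))
  ≡⟨ cong (λ z → concatMap copies (map suc z)) (sym (applyUpTo-∷ʳ id m)) ⟩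
    concatMap copies (map suc (upTo m ++ [ m ]))
  ≡⟨ cong (concatMap copies) (map-++ suc (upTo m) [ m ]) ⟩
    concatMap copies (map suc (upTo m) ++ [ suc m ])
  ≡⟨ concatMap-++ copies (map suc (upTo m)) [ suc m ] ⟩
    multList m a ++ (replicate (a (suc m)) (suc m) ++ [])
  ≡⟨ cong (multList m a ++_) (++-identityʳ _) ⟩
    multList m a ++ replicate (a (suc m)) (suc m)
  ∎
  where
  open ≡-Reasoning
  copies : ℕ → List ℕ
  copies i = replicate (a i) i

peel : ∀ m a → (∀ i → 1 ≤ i → i ≤ m → 1 ≤ a i) →
       multList m a ↭ multList m (λ i → a i ∸ 1) ++ run 1 m
peel zero a pos = ↭-refl
peel (suc m) a pos = begin
    multList (suc m) a
  ≡⟨ multList-suc m a ⟩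
    multList m a ++ replicate (a (suc m)) (suc m)
  ≡⟨ cong (λ z → multList m a ++ replicate z (suc m)) (sym (m+[n∸m]≡n (pos (suc m) (s≤s z≤n) ≤-refl))) ⟩
    multList m a ++ (suc m ∷ R)
  ↭⟨ ++⁺ʳ _ (peel m a (λ i p q → pos i p (≤-trans q (n≤1+n m)))) ⟩
    (A ++ run 1 m) ++ (suc m ∷ R)
  ≡⟨ ++-assoc A (run 1 m) (suc m ∷ R) ⟩
    A ++ (run 1 m ++ (suc m ∷ R))
  ↭⟨ ++⁺ˡ A (++-comm (run 1 m) (suc m ∷ R)) ⟩
    A ++ (suc m ∷ (R ++ run 1 m))
  ↭⟨ ++⁺ˡ A (++-comm [ suc m ] (R ++ run 1 m)) ⟩
    A ++ ((R ++ run 1 m) ++ [ suc m ])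
  ≡⟨ cong (A ++_) (++-assoc R (run 1 m) [ suc m ]) ⟩
    A ++ (R ++ (run 1 m ++ [ suc m ]))
  ≡⟨ sym (++-assoc A R _) ⟩
    (A ++ R) ++ (run 1 m ++ [ suc m ])
  ≡⟨ cong₂ _++_ (sym (multList-suc m (λ i → a i ∸ 1))) (sym (run-∷ʳ 1 m)) ⟩
    multList (suc m) (λ i → a i ∸ 1) ++ run 1 (suc m)
  ∎
  where
  open PermutationReasoning
  A = multList m (λ i → a i ∸ 1)
  R = replicate (a (suc m) ∸ 1) (suc m)

Descending : ℕ → (ℕ → ℕ) → Set
Descending m a = ∀ i → 2 ≤ i → suc i ≤ m → a (suc i) ≤ a i

descending-≤ : ∀ {m a i k} → Descending m a → 2 ≤ i → i ≤′ k → k ≤ m → a k ≤ a i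
descending-≤ desc 2≤i ≤′-refl _ = ≤-refl
descending-≤ {i = i} desc 2≤i (≤′-step {k} i≤′k) 1+k≤m =
  ≤-trans (desc k (≤-trans 2≤i (≤′⇒≤ i≤′k)) 1+k≤m) (descending-≤ desc 2≤i i≤′k (≤-trans (n≤1+n k) 1+k≤m))

-- Under the hypotheses, a positive top multiplicity a m forces all of
-- a 1, …, a m to be positive (a 1 > a 3 ≥ a m and a i ≥ a m for i ≥ 2).
positive : ∀ {m a} → Descending m a → 3 ≤ m → a 3 < a 1 → 1 ≤ a m →
           ∀ i → 1 ≤ i → i ≤ m → 1 ≤ a i
positive desc 3≤m a₃<a₁ top (suc zero) _ _ =
  ≤-trans top (≤-trans (descending-≤ desc (s≤s (s≤s z≤n)) (≤⇒≤′ 3≤m) ≤-refl) (<⇒≤ a₃<a₁))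
positive desc 3≤m a₃<a₁ top (suc (suc i)) _ i≤m =
  ≤-trans top (descending-≤ desc (s≤s (s≤s z≤n)) (≤⇒≤′ i≤m) ≤-refl)

-- Base of the induction, m = 3 and a 3 = 0: realize {1, 2^{a 2}}, then add
-- the remaining a 1 - 1 ones.
baseCase : ∀ a → a 3 ≡ 0 → 1 ≤ a 1 → Realization (multList 3 a) 0
baseCase a a₃≡0 1≤a₁ with m≤n⇒∃[o]m+o≡n 1≤a₁
... | k , a₁≡ = Realization-resp perm (appendOnes k (twosRealization (a 2)))
  where
  perm : (1 ∷ replicate (a 2) 2) ++ replicate k 1 ↭ multList 3 a
  perm = begin
      1 ∷ (replicate (a 2) 2 ++ replicate k 1)
    ↭⟨ prep 1 (++-comm (replicate (a 2) 2) (replicate k 1)) ⟩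
      replicate (suc k) 1 ++ replicate (a 2) 2
    ≡⟨ cong (replicate (suc k) 1 ++_) (sym (++-identityʳ (replicate (a 2) 2))) ⟩
      replicate (suc k) 1 ++ (replicate (a 2) 2 ++ (replicate 0 3 ++ []))
    ≡⟨ cong₂ (λ u w → replicate u 1 ++ (replicate (a 2) 2 ++ (replicate w 3 ++ []))) a₁≡ (sym a₃≡0) ⟩
      replicate (a 1) 1 ++ (replicate (a 2) 2 ++ (replicate (a 3) 3 ++ []))
    ∎
    where open PermutationReasoning

multList-dropTop : ∀ m a → a (suc m) ≡ 0 → multList (suc m) a ≡ multList m a
multList-dropTop m a top≡0 =
  trans (multList-suc m a) (trans (cong (λ z → multList m a ++ replicate z (suc m)) top≡0) (++-identityʳ _))

-- A realization of the multiset, open less than m below the top (so that it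
-- can be extended by a layer {1, …, m}).
Open : ℕ → (ℕ → ℕ) → Set
Open m a = Σ ℕ λ y → y < m × Realization (multList m a) y

addLayer : ∀ j a → (∀ i → 1 ≤ i → i ≤ 3 + j → 1 ≤ a i) → Open (3 + j) (λ i → a i ∸ 1) → Open (3 + j) a
addLayer j a pos (y , y<m , R) with extend (2 + j) (≤-pred y<m) R
... | y′ , y′≤ , R′ = y′ , s≤s y′≤ , Realization-resp (↭-sym (peel (3 + j) a pos)) R′

-- Induction on m = 3 + j and, for fixed m, on the top multiplicity c = a m.
realize : ∀ j c a → a (3 + j) ≡ c → Descending (3 + j) a → a 3 < a 1 → Open (3 + j) a
realize zero zero a a₃≡0 desc a₃<a₁ = 0 , s≤s z≤n , baseCase a a₃≡0 (≤-trans (s≤s z≤n) a₃<a₁)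
realize (suc j) zero a top≡0 desc a₃<a₁
  with realize j (a (3 + j)) a refl (λ i p q → desc i p (≤-trans q (n≤1+n _))) a₃<a₁
... | y , y<m , R = y , ≤-trans y<m (n≤1+n _) , subst (λ L → Realization L y) (sym (multList-dropTop (3 + j) a top≡0)) R
realize j (suc c) a top≡c desc a₃<a₁ =
  addLayer j a pos
    (realize j c (λ i → a i ∸ 1) (cong (_∸ 1) top≡c) (λ i p q → ∸-monoˡ-≤ 1 (desc i p q))
      (∸-monoˡ-< a₃<a₁ (pos 3 (s≤s z≤n) (m≤m+n 3 j))))
  where
  pos : ∀ i → 1 ≤ i → i ≤ 3 + j → 1 ≤ a i
  pos = positive desc (m≤m+n 3 j) a₃<a₁ (subst (1 ≤_) (sym top≡c) (s≤s z≤n))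

corollary6p8 : (m : ℕ) → 3 ≤ m → (a : ℕ → ℕ) →
    (∀ i → 2 ≤ i → suc i ≤ m → a (suc i) ≤ a i) →
    a 3 < a 1 →
    LinearRealization (multList m a)
corollary6p8 m 3≤m a desc a₃<a₁ with m≤n⇒∃[o]m+o≡n 3≤m
... | j , refl with realize j (a (3 + j)) a refl desc a₃<a₁
...   | _ , _ , realization xs _ _ _ _ vx dx = xs , ↭-trans vx (↭-reflexive (sym (upTo≡run _))) , dx
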